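{- If $A\in\mathbb{N}^{k\times k}$, then for all $u,v\in[k]$ the function $n\mapsto(A^n)_{uv}$ is an ultimately almost PORC function.
   Context: $\mathbb{N}=\{0,1,2,\dots\}$, $[k]=\{1,\dots,k\}$. A function $\varphi:\mathbb{N}\to\mathbb{N}$ is ultimately almost PORC if there are a quasiperiod $p\in\mathbb{N}\setminus\{0\}$, an offset $N\in\mathbb{N}$ and constituents $\varphi_0,\dots,\varphi_{p-1}:\mathbb{N}\to\mathbb{Q}$, each of which is either a polynomial with rational coefficients or a function in $2^{\Theta(n)}$ (i.e. bounded between $2^{\gamma_1 n}$ and $2^{\gamma_2 n}$ for large $n$, for constants $0<\gamma_1\le\gamma_2$), such that $\varphi(n)=\varphi_{n\operatorname{rem}p}(n)$ for all $n\ge N$, where $n\operatorname{rem}p\in\{0,\dots,p-1\}$ is the remainder of $n$ modulo $p$. -}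

module Defs where

open import Data.Nat as ℕ using (ℕ; zero; suc)
open import Data.Nat.DivMod using (_mod_)
open import Data.Integer using (+_)
open import Data.Rational as ℚ using (ℚ; 0ℚ; 1ℚ)
open import Data.Fin using (Fin)
open import Data.List using (List; []; _∷_)
open import Data.Product using (Σ; ∃; _×_; _,_)
open import Data.Sum using (_⊎_)
open import Relation.Binary.PropositionalEquality using (_≡_)

toℚ : ℕ → ℚ
toℚ n = (+ n) ℚ./ 1

_^ℚ_ : ℚ → ℕ → ℚ
x ^ℚ zero  = 1ℚ
x ^ℚ suc n = x ℚ.* (x ^ℚ n)

Mat : ℕ → Set
Mat k = Fin k → Fin k → ℕ

sumFin : ∀ {k} → (Fin k → ℕ) → ℕ
sumFin {zero}  f = 0
sumFin {suc k} f = f Fin.zero ℕ.+ sumFin (λ i → f (Fin.suc i))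

_⊗_ : ∀ {k} → Mat k → Mat k → Mat k
(A ⊗ B) u v = sumFin (λ w → A u w ℕ.* B w v)

idMat : ∀ {k} → Mat k
idMat {suc k} Fin.zero    Fin.zero    = 1
idMat {suc k} (Fin.suc i) (Fin.suc j) = idMat i j
idMat _ _ = 0

_^M_ : ∀ {k} → Mat k → ℕ → Mat k
A ^M zero  = idMat
A ^M suc n = A ⊗ (A ^M n)

evalPoly : List ℚ → ℚ → ℚ
evalPoly []       x = 0ℚ
evalPoly (c ∷ cs) x = c ℚ.+ x ℚ.* evalPoly cs x

IsPolynomial : (ℕ → ℚ) → Set
IsPolynomial f = Σ (List ℚ) λ cs → ∀ n → f n ≡ evalPoly cs (toℚ n)

-- f ∈ 2^Θ(n): there are constants 0 < γ₁ ≤ γ₂ with 2^(γ₁ n) ≤ f n ≤ 2^(γ₂ n)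
-- for all large n.  Constants taken rational: γ₁ = suc a₁ / suc b₁, γ₂ = a₂ / suc b₂;
-- for f n ≥ 0, 2^(a n / b) ≤ f n  ⇔  2^(a n) ≤ (f n)^b.
IsExpTheta : (ℕ → ℚ) → Set
IsExpTheta f = Σ ℕ λ a₁ → Σ ℕ λ b₁ → Σ ℕ λ a₂ → Σ ℕ λ b₂ →
  (suc a₁ ℕ.* suc b₂ ℕ.≤ a₂ ℕ.* suc b₁) ×
  Σ ℕ λ M → ∀ n → M ℕ.≤ n →
      (0ℚ ℚ.≤ f n)
    × (toℚ (2 ℕ.^ (suc a₁ ℕ.* n)) ℚ.≤ f n ^ℚ suc b₁)
    × (f n ^ℚ suc b₂ ℚ.≤ toℚ (2 ℕ.^ (a₂ ℕ.* n)))

-- ultimately almost PORC, quasiperiod p = suc q, offset N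
UltimatelyAlmostPORC : (ℕ → ℕ) → Set
UltimatelyAlmostPORC φ = Σ ℕ λ q → Σ ℕ λ N → Σ (Fin (suc q) → ℕ → ℚ) λ φs →
    (∀ i → IsPolynomial (φs i) ⊎ IsExpTheta (φs i))
  × (∀ n → N ℕ.≤ n → toℚ (φ n) ≡ φs (n mod suc q) n)

-- Some power B = A^p has transitive support: the support patterns of the powers of A
-- eventually repeat (pigeonhole), and p can be taken with supp A^(p+p) ⊆ supp A^p.
-- Then (A^(r + m p))_uv = Σ_y (A^r)_uy (B^m)_yv, so it suffices to follow the entries
-- (B^m)_xv of one column. If B_xv = 0 they vanish for m ≥ 1; if x has a loop of weight
-- at least 2 or lies on a 2-cycle they grow at least like 2^m. Otherwise
-- (B^(m+1))_xv = B_xx (B^m)_xv + Σ_{w ≠ x} B_xw (B^m)_wv with B_xx ≤ 1 and B_wx = 0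
-- whenever B_xw > 0; by transitivity such w reach strictly fewer vertices than x, so by
-- induction each summand is eventually a ℕ-combination Σ c_j C(m, j) of binomial
-- coefficients (a polynomial in m) or grows like 2^m, and the recurrence preserves this.
-- On each residue class modulo p the entry is therefore a polynomial in n or lies
-- between 2^(n/(p+1)) and 2^(c n), the upper bound coming from the entry sum of A.

module Submission where

open import Defs
open import Data.Bool using (if_then_else_)
open import Data.Fin as Fin using (Fin; zero; suc; toℕ; funToFin; finToFun)
open import Data.Fin.Properties as Finₚ using (finToFun-funToFin; pigeonhole)
open import Data.Fin.Subset using (Subset; Side; inside; outside; _∈_; _⊂_; ⁅_⁆; _∪_)
open import Data.Fin.Subset.Induction using (⊂-wellFounded)
open import Data.Fin.Subset.Properties using (x∈⁅x⁆; x∈⁅y⁆⇒x≡y; x∈p∪q⁻; p⊆p∪q; q⊆p∪q)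
open import Data.Integer as ℤ using ()
open import Data.Integer.Properties as ℤ using ()
open import Data.List using (List; []; _∷_; map)
open import Data.Nat
  using (ℕ; zero; suc; _+_; _*_; _∸_; _^_; _≤_; _<_; _≤?_; _<?_; z≤n; s≤s; z<s; >-nonZero)
open import Data.Nat.Combinatorics using (_C_; nC1≡n) renaming (nCk+nC[k+1]≡[n+1]C[k+1] to pascal)
open import Data.Nat.Coprimality as Coprimality using ()
open import Data.Nat.DivMod using (_%_; _/_; _mod_; m≡m%n+[m/n]*n)
open import Data.Nat.GeneralisedArithmetic using (iterate)
open import Data.Nat.Properties as ℕ using ()
open import Algebra.Properties.CommutativeSemigroup ℕ.+-commutativeSemigroup
  using () renaming (interchange to +-interchange; x∙yz≈y∙xz to +-exchangeˡ)
open import Data.Nat.Tactic.RingSolver using (solve)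
open import Data.Product as Product using (∃; ∃₂; _×_; _,_; proj₁; proj₂)
open import Data.Rational as ℚ using (ℚ; mkℚ; 0ℚ; 1ℚ)
open import Data.Rational.Properties as ℚ using ()
open import Data.Rational.Solver using (module +-*-Solver)
open import Data.Sum using (_⊎_; inj₁; inj₂)
open import Data.Vec using (tabulate)
open import Data.Vec.Properties using (lookup∘tabulate; []=⇒lookup; lookup⇒[]=)
open import Function using (_∘_; id; _on_)
open import Induction.WellFounded using (Acc; acc)
open import Relation.Binary.Construct.On as On using ()
open import Relation.Binary.PropositionalEquality
  using (_≡_; _≢_; _≗_; refl; sym; trans; cong; cong₂; subst; subst₂; module ≡-Reasoning)
open import Relation.Nullary using (¬_; does; yes; no; contradiction)
open import Relation.Nullary.Decidable using (¬?; _×-dec_)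

open +-*-Solver using (_:+_; _:*_; _:=_; con; :-_) renaming (solve to solveℚ)

sumFin-cong : ∀ {k} {f g : Fin k → ℕ} → f ≗ g → sumFin f ≡ sumFin g
sumFin-cong {zero}  f≗g = refl
sumFin-cong {suc k} f≗g = cong₂ _+_ (f≗g zero) (sumFin-cong (f≗g ∘ suc))

sumFin-zero : ∀ k → sumFin {k} (λ _ → 0) ≡ 0
sumFin-zero zero    = refl
sumFin-zero (suc k) = sumFin-zero k

sumFin-distrib-+ : ∀ {k} (f g : Fin k → ℕ) → sumFin (λ i → f i + g i) ≡ sumFin f + sumFin g
sumFin-distrib-+ {zero}  f g = refl
sumFin-distrib-+ {suc k} f g = begin
  (f zero + g zero) + sumFin (λ i → f (suc i) + g (suc i))
    ≡⟨ cong (f zero + g zero +_) (sumFin-distrib-+ (f ∘ suc) (g ∘ suc)) ⟩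
  (f zero + g zero) + (sumFin (f ∘ suc) + sumFin (g ∘ suc))
    ≡⟨ +-interchange (f zero) (g zero) _ _ ⟩
  (f zero + sumFin (f ∘ suc)) + (g zero + sumFin (g ∘ suc)) ∎
  where open ≡-Reasoning

sumFin-comm : ∀ {k l} (f : Fin k → Fin l → ℕ) →
              sumFin (λ i → sumFin (f i)) ≡ sumFin (λ j → sumFin (λ i → f i j))
sumFin-comm {zero}  {l} f = sym (sumFin-zero l)
sumFin-comm {suc k}     f = trans (cong (sumFin (f zero) +_) (sumFin-comm (f ∘ suc)))
                                  (sym (sumFin-distrib-+ (f zero) _))

*-distribˡ-sumFin : ∀ {k} c (f : Fin k → ℕ) → c * sumFin f ≡ sumFin (λ i → c * f i)
*-distribˡ-sumFin {zero}  c f = ℕ.*-zeroʳ c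
*-distribˡ-sumFin {suc k} c f =
  trans (ℕ.*-distribˡ-+ c (f zero) _) (cong (c * f zero +_) (*-distribˡ-sumFin c (f ∘ suc)))

*-distribʳ-sumFin : ∀ {k} c (f : Fin k → ℕ) → sumFin f * c ≡ sumFin (λ i → f i * c)
*-distribʳ-sumFin {zero}  c f = refl
*-distribʳ-sumFin {suc k} c f =
  trans (ℕ.*-distribʳ-+ c (f zero) _) (cong (f zero * c +_) (*-distribʳ-sumFin c (f ∘ suc)))

sumFin-mono-≤ : ∀ {k} {f g : Fin k → ℕ} → (∀ i → f i ≤ g i) → sumFin f ≤ sumFin g
sumFin-mono-≤ {zero}  f≤g = z≤n
sumFin-mono-≤ {suc k} f≤g = ℕ.+-mono-≤ (f≤g zero) (sumFin-mono-≤ (f≤g ∘ suc))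

≤-sumFin : ∀ {k} (f : Fin k → ℕ) i → f i ≤ sumFin f
≤-sumFin f zero    = ℕ.m≤m+n (f zero) _
≤-sumFin f (suc i) = ℕ.≤-trans (≤-sumFin (f ∘ suc) i) (ℕ.m≤n+m _ (f zero))

sumFin-positive : ∀ {k} (f : Fin k → ℕ) → 0 < sumFin f → ∃ λ i → 0 < f i
sumFin-positive {suc k} f 0<Σf with f zero in f₀≡
... | suc _ = zero , subst (0 <_) (sym f₀≡) z<s
... | zero  = Product.map suc id (sumFin-positive (f ∘ suc) 0<Σf)

_without_ : ∀ {k} → (Fin k → ℕ) → Fin k → Fin k → ℕ
(f without i) j = if does (j Fin.≟ i) then 0 else f j

without-≢ : ∀ {k} (f : Fin k → ℕ) {i j} → j ≢ i → (f without i) j ≡ f j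
without-≢ f {i} {j} j≢i with j Fin.≟ i
... | yes j≡i = contradiction j≡i j≢i
... | no  _   = refl

sumFin-without : ∀ {k} (i : Fin k) (f : Fin k → ℕ) → sumFin f ≡ f i + sumFin (f without i)
sumFin-without zero    f = refl
sumFin-without (suc i) f = begin
  f zero + sumFin (f ∘ suc)                           ≡⟨ cong (f zero +_) (sumFin-without i (f ∘ suc)) ⟩
  f zero + (f (suc i) + sumFin ((f ∘ suc) without i)) ≡⟨ +-exchangeˡ (f zero) (f (suc i)) _ ⟩
  f (suc i) + (f zero + sumFin ((f ∘ suc) without i)) ∎
  where open ≡-Reasoning

infix 4 _≋_
_≋_ : ∀ {k} → Mat k → Mat k → Set
A ≋ B = ∀ u v → A u v ≡ B u v

≋-refl : ∀ {k} {A : Mat k} → A ≋ A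
≋-refl u v = refl

≋-trans : ∀ {k} {A B C : Mat k} → A ≋ B → B ≋ C → A ≋ C
≋-trans A≋B B≋C u v = trans (A≋B u v) (B≋C u v)

⊗-cong : ∀ {k} {A A′ B B′ : Mat k} → A ≋ A′ → B ≋ B′ → (A ⊗ B) ≋ (A′ ⊗ B′)
⊗-cong A≋A′ B≋B′ u v = sumFin-cong λ w → cong₂ _*_ (A≋A′ u w) (B≋B′ w v)

sumFin-idMatˡ : ∀ {k} (u : Fin k) (f : Fin k → ℕ) → sumFin (λ w → idMat u w * f w) ≡ f u
sumFin-idMatˡ {suc k} zero    f = begin
  f zero + 0 + sumFin {k} (λ _ → 0) ≡⟨ cong₂ _+_ (ℕ.+-identityʳ (f zero)) (sumFin-zero k) ⟩
  f zero + 0                        ≡⟨ ℕ.+-identityʳ (f zero) ⟩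
  f zero                            ∎
  where open ≡-Reasoning
sumFin-idMatˡ {suc k} (suc u) f = sumFin-idMatˡ u (f ∘ suc)

idMat-sym : ∀ {k} (u v : Fin k) → idMat u v ≡ idMat v u
idMat-sym {suc k} zero    zero    = refl
idMat-sym {suc k} zero    (suc v) = refl
idMat-sym {suc k} (suc u) zero    = refl
idMat-sym {suc k} (suc u) (suc v) = idMat-sym u v

sumFin-idMatʳ : ∀ {k} (v : Fin k) (f : Fin k → ℕ) → sumFin (λ w → f w * idMat w v) ≡ f v
sumFin-idMatʳ v f =
  trans (sumFin-cong λ w → trans (ℕ.*-comm (f w) _) (cong (_* f w) (idMat-sym w v))) (sumFin-idMatˡ v f)

⊗-identityˡ : ∀ {k} (A : Mat k) → (idMat ⊗ A) ≋ A
⊗-identityˡ A u v = sumFin-idMatˡ u (λ w → A w v)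

⊗-identityʳ : ∀ {k} (A : Mat k) → (A ⊗ idMat) ≋ A
⊗-identityʳ A u v = sumFin-idMatʳ v (A u)

⊗-assoc : ∀ {k} (A B C : Mat k) → ((A ⊗ B) ⊗ C) ≋ (A ⊗ (B ⊗ C))
⊗-assoc A B C u v = begin
  sumFin (λ w → sumFin (λ z → A u z * B z w) * C w v)
    ≡⟨ sumFin-cong (λ w → *-distribʳ-sumFin (C w v) (λ z → A u z * B z w)) ⟩
  sumFin (λ w → sumFin (λ z → A u z * B z w * C w v))
    ≡⟨ sumFin-comm (λ w z → A u z * B z w * C w v) ⟩
  sumFin (λ z → sumFin (λ w → A u z * B z w * C w v))
    ≡⟨ sumFin-cong (λ z → sumFin-cong (λ w → ℕ.*-assoc (A u z) (B z w) (C w v))) ⟩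
  sumFin (λ z → sumFin (λ w → A u z * (B z w * C w v)))
    ≡⟨ sumFin-cong (λ z → *-distribˡ-sumFin (A u z) (λ w → B z w * C w v)) ⟨
  sumFin (λ z → A u z * sumFin (λ w → B z w * C w v)) ∎
  where open ≡-Reasoning

^M-+ : ∀ {k} (A : Mat k) m n → (A ^M (m + n)) ≋ ((A ^M m) ⊗ (A ^M n))
^M-+ A zero    n u v = sym (⊗-identityˡ (A ^M n) u v)
^M-+ A (suc m) n     =
  ≋-trans (⊗-cong (≋-refl {A = A}) (^M-+ A m n)) (λ u v → sym (⊗-assoc A (A ^M m) (A ^M n) u v))

^M-* : ∀ {k} (A : Mat k) m p → (A ^M (m * p)) ≋ ((A ^M p) ^M m)
^M-* A zero    p u v = refl
^M-* A (suc m) p     = ≋-trans (^M-+ A p (m * p)) (⊗-cong (≋-refl {A = A ^M p}) (^M-* A m p))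

*-positive⁻ : ∀ a b → 0 < a * b → 0 < a × 0 < b
*-positive⁻ (suc a) zero    0<ab = contradiction (subst (0 <_) (ℕ.*-zeroʳ (suc a)) 0<ab) λ ()
*-positive⁻ (suc a) (suc b) _    = z<s , z<s

⊗-positive⁺ : ∀ {k} (A B : Mat k) {u v} w → 0 < A u w → 0 < B w v → 0 < (A ⊗ B) u v
⊗-positive⁺ A B {u} {v} w 0<A 0<B =
  ℕ.<-≤-trans (ℕ.*-mono-< 0<A 0<B) (≤-sumFin (λ z → A u z * B z v) w)

⊗-positive⁻ : ∀ {k} (A B : Mat k) {u v} → 0 < (A ⊗ B) u v → ∃ λ w → 0 < A u w × 0 < B w v
⊗-positive⁻ A B {u} {v} 0<AB with sumFin-positive (λ w → A u w * B w v) 0<AB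
... | w , 0<AB[w] = w , *-positive⁻ (A u w) (B w v) 0<AB[w]

mass : ∀ {k} → Mat k → ℕ
mass A = sumFin (λ a → sumFin (A a))

idMat-≤1 : ∀ {k} (u v : Fin k) → idMat u v ≤ 1
idMat-≤1 {suc k} zero    zero    = ℕ.≤-refl
idMat-≤1 {suc k} zero    (suc v) = z≤n
idMat-≤1 {suc k} (suc u) zero    = z≤n
idMat-≤1 {suc k} (suc u) (suc v) = idMat-≤1 u v

^M-≤-mass^ : ∀ {k} (A : Mat k) n u v → (A ^M n) u v ≤ mass A ^ n
^M-≤-mass^ A zero    u v = idMat-≤1 u v
^M-≤-mass^ A (suc n) u v = begin
  sumFin (λ w → A u w * (A ^M n) w v)
    ≤⟨ sumFin-mono-≤ (λ w → ℕ.*-monoʳ-≤ (A u w) (^M-≤-mass^ A n w v)) ⟩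
  sumFin (λ w → A u w * mass A ^ n)
    ≡⟨ *-distribʳ-sumFin (mass A ^ n) (A u) ⟨
  sumFin (A u) * mass A ^ n
    ≤⟨ ℕ.*-monoˡ-≤ (mass A ^ n) (≤-sumFin (λ a → sumFin (A a)) u) ⟩
  mass A * mass A ^ n ∎
  where open ℕ.≤-Reasoning

-- Supports of powers

infix 4 _⊑_
_⊑_ : ∀ {k} → Mat k → Mat k → Set
M ⊑ N = ∀ u v → 0 < M u v → 0 < N u v

⊑-refl : ∀ {k} {M : Mat k} → M ⊑ M
⊑-refl u v = id

⊑-trans : ∀ {k} {L M N : Mat k} → L ⊑ M → M ⊑ N → L ⊑ N
⊑-trans L⊑M M⊑N u v = M⊑N u v ∘ L⊑M u v

⊗-monoʳ-⊑ : ∀ {k} (A : Mat k) {M N} → M ⊑ N → (A ⊗ M) ⊑ (A ⊗ N)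
⊗-monoʳ-⊑ A {M} {N} M⊑N u v 0<AM with ⊗-positive⁻ A M 0<AM
... | w , 0<A , 0<M = ⊗-positive⁺ A N w 0<A (M⊑N w v 0<M)

TransitiveSupport : ∀ {k} → Mat k → Set
TransitiveSupport {k} B = ∀ (x z y : Fin k) → 0 < B x z → 0 < B z y → 0 < B x y

transitive-^M-⊑ : ∀ {k} {B : Mat k} → TransitiveSupport B → ∀ m → (B ^M suc m) ⊑ B
transitive-^M-⊑ {B = B} transitive zero    u v 0<B = subst (0 <_) (⊗-identityʳ B u v) 0<B
transitive-^M-⊑ {B = B} transitive (suc m) u v 0<BBᵐ with ⊗-positive⁻ B (B ^M suc m) 0<BBᵐ
... | w , 0<Buw , 0<Bᵐwv = transitive u w v 0<Buw (transitive-^M-⊑ transitive m w v 0<Bᵐwv)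

sign : ℕ → Fin 2
sign zero    = zero
sign (suc _) = suc zero

supportCode : ∀ {k} → Mat k → Fin ((2 ^ k) ^ k)
supportCode M = funToFin (λ u → funToFin (λ v → sign (M u v)))

funToFin-injective : ∀ {m n} {f g : Fin m → Fin n} → funToFin f ≡ funToFin g → f ≗ g
funToFin-injective {f = f} {g} eq i =
  trans (sym (finToFun-funToFin f i)) (trans (cong (λ c → finToFun c i) eq) (finToFun-funToFin g i))

supportCode-⊑ : ∀ {k} {M N : Mat k} → supportCode M ≡ supportCode N → M ⊑ N
supportCode-⊑ {M = M} {N} eq u v 0<M
  with M u v | N u v | funToFin-injective (funToFin-injective eq u) v
... | suc _ | suc _ | _  = z<s
... | suc _ | zero  | ()

ℕ-pigeonhole : ∀ {m} (s : ℕ → Fin m) → ∃₂ λ i d → s i ≡ s (i + suc d)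
ℕ-pigeonhole {m} s with pigeonhole (ℕ.n<1+n m) (s ∘ toℕ)
... | i , j , i<j , sᵢ≡sⱼ with ℕ.m≤n⇒∃[o]m+o≡n i<j
...   | d , i+1+d≡j = toℕ i , d , trans sᵢ≡sⱼ (cong s (trans (sym i+1+d≡j) (sym (ℕ.+-suc (toℕ i) d))))

powers-support-recur : ∀ {k} (A : Mat k) → ∃₂ λ i d → (A ^M (i + suc d)) ⊑ (A ^M i)
powers-support-recur A with ℕ-pigeonhole (supportCode ∘ (A ^M_))
... | i , d , codeᵢ≡codeᵢ₊ₙ = i , d , supportCode-⊑ (sym codeᵢ≡codeᵢ₊ₙ)

module _ {k} (A : Mat k) {i D : ℕ} (recur : (A ^M (i + D)) ⊑ (A ^M i)) where

  private
    reindex : ∀ {m m′ n n′} → m ≡ m′ → n ≡ n′ → (A ^M m) ⊑ (A ^M n) → (A ^M m′) ⊑ (A ^M n′)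
    reindex refl refl = id

  ^M-⊑-shift : ∀ t → (A ^M (t + i + D)) ⊑ (A ^M (t + i))
  ^M-⊑-shift zero    = recur
  ^M-⊑-shift (suc t) = ⊗-monoʳ-⊑ A (^M-⊑-shift t)

  ^M-⊑-iterate : ∀ c t → (A ^M (t + i + c * D)) ⊑ (A ^M (t + i))
  ^M-⊑-iterate zero    t = reindex {n = t + i} (sym (ℕ.+-identityʳ (t + i))) refl ⊑-refl
  ^M-⊑-iterate (suc c) t = ⊑-trans (reindex e₁ e₂ (^M-⊑-shift (t + c * D))) (^M-⊑-iterate c t)
    where
      e₁ : t + c * D + i + D ≡ t + i + suc c * D
      e₁ = solve (t ∷ c ∷ D ∷ i ∷ [])
      e₂ : t + c * D + i ≡ t + i + c * D
      e₂ = solve (t ∷ c ∷ D ∷ i ∷ [])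

transitive-power : ∀ {k} (A : Mat k) → ∃ λ q → TransitiveSupport (A ^M suc q)
transitive-power A with powers-support-recur A
... | i , d , recur = d + i * suc d , transitive
  where
    -- a multiple of the period 1 + d that is at least i
    p = suc i * suc d
    p+p⊑p : (A ^M (p + p)) ⊑ (A ^M p)
    p+p⊑p = subst₂ (λ m n → (A ^M m) ⊑ (A ^M n)) e₁ e₂ (^M-⊑-iterate A recur (suc i) (suc d + i * d))
      where
        e₁ : suc d + i * d + i + suc i * suc d ≡ suc i * suc d + suc i * suc d
        e₁ = solve (d ∷ i ∷ [])
        e₂ : suc d + i * d + i ≡ suc i * suc d
        e₂ = solve (d ∷ i ∷ [])
    transitive : TransitiveSupport (A ^M p)
    transitive x z y 0<xz 0<zy =
      p+p⊑p x y (subst (0 <_) (sym (^M-+ A p p x y)) (⊗-positive⁺ (A ^M p) (A ^M p) z 0<xz 0<zy))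

positivity : ℕ → Side
positivity zero    = outside
positivity (suc _) = inside

support : ∀ {k} → (Fin k → ℕ) → Subset k
support f = tabulate (positivity ∘ f)

∈-support⁺ : ∀ {k} (f : Fin k → ℕ) {w} → 0 < f w → w ∈ support f
∈-support⁺ f {w} 0<fw =
  lookup⇒[]= w (support f) (trans (lookup∘tabulate (positivity ∘ f) w) (positive 0<fw))
  where
    positive : ∀ {n} → 0 < n → positivity n ≡ inside
    positive z<s = refl

∈-support⁻ : ∀ {k} (f : Fin k → ℕ) {w} → w ∈ support f → 0 < f w
∈-support⁻ f {w} w∈f = positive (trans (sym (lookup∘tabulate (positivity ∘ f) w)) ([]=⇒lookup w∈f))
  where
    positive : ∀ {n} → positivity n ≡ inside → 0 < n
    positive {suc _} _ = z<s

-- Newton series and the polynomial-or-exponential dichotomy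

-- Σⱼ csⱼ · C(m, j), given through its forward differences (newton≡binomialSum).
newton : List ℕ → ℕ → ℕ
newton []       _       = 0
newton (c ∷ cs) zero    = c
newton (c ∷ cs) (suc m) = newton (c ∷ cs) m + newton cs m

advance : List ℕ → List ℕ
advance []       = []
advance (c ∷ cs) = c + newton cs 0 ∷ advance cs

newton-advance : ∀ cs m → newton (advance cs) m ≡ newton cs (suc m)
newton-advance []       m       = refl
newton-advance (c ∷ cs) zero    = refl
newton-advance (c ∷ cs) (suc m) = cong₂ _+_ (newton-advance (c ∷ cs) m) (newton-advance cs m)

newton-iterate-advance : ∀ n cs m → newton (iterate advance cs n) m ≡ newton cs (n + m)
newton-iterate-advance zero    cs m = refl
newton-iterate-advance (suc n) cs m =
  trans (newton-iterate-advance n (advance cs) m) (newton-advance cs (n + m))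

infixl 6 _⊕_
_⊕_ : List ℕ → List ℕ → List ℕ
[]       ⊕ ds       = ds
(c ∷ cs) ⊕ []       = c ∷ cs
(c ∷ cs) ⊕ (d ∷ ds) = c + d ∷ cs ⊕ ds

newton-⊕ : ∀ cs ds m → newton (cs ⊕ ds) m ≡ newton cs m + newton ds m
newton-⊕ []       ds       m       = refl
newton-⊕ (c ∷ cs) []       m       = sym (ℕ.+-identityʳ _)
newton-⊕ (c ∷ cs) (d ∷ ds) zero    = refl
newton-⊕ (c ∷ cs) (d ∷ ds) (suc m) =
  trans (cong₂ _+_ (newton-⊕ (c ∷ cs) (d ∷ ds) m) (newton-⊕ cs ds m))
        (+-interchange (newton (c ∷ cs) m) (newton (d ∷ ds) m) (newton cs m) (newton ds m))

newton-scale : ∀ a cs m → newton (map (a *_) cs) m ≡ a * newton cs m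
newton-scale a []       m       = sym (ℕ.*-zeroʳ a)
newton-scale a (c ∷ cs) zero    = refl
newton-scale a (c ∷ cs) (suc m) =
  trans (cong₂ _+_ (newton-scale a (c ∷ cs) m) (newton-scale a cs m)) (sym (ℕ.*-distribˡ-+ a _ _))

data PolyOrExp (g : ℕ → ℕ) : Set where
  poly : ∀ M cs → (∀ m → g (M + m) ≡ newton cs m) → PolyOrExp g
  exp  : ∀ M → (∀ m → 2 ^ m ≤ g (M + m)) → PolyOrExp g

PolyOrExp-cong : ∀ {f g} → f ≗ g → PolyOrExp f → PolyOrExp g
PolyOrExp-cong f≗g (poly M cs f≡) = poly M cs λ m → trans (sym (f≗g (M + m))) (f≡ m)
PolyOrExp-cong f≗g (exp M grow)   = exp M λ m → subst (2 ^ m ≤_) (f≗g (M + m)) (grow m)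

PolyOrExp-0 : PolyOrExp (λ _ → 0)
PolyOrExp-0 = poly 0 [] λ _ → refl

PolyOrExp-+ : ∀ {f g} → PolyOrExp f → PolyOrExp g → PolyOrExp (λ m → f m + g m)
PolyOrExp-+ {f} {g} (poly M cs f≡) (poly N ds g≡) = poly (M + N) (cs′ ⊕ ds′) λ m → begin
  f (M + N + m) + g (M + N + m)
    ≡⟨ cong₂ _+_ (cong f (ℕ.+-assoc M N m)) (cong g (solve (M ∷ N ∷ m ∷ []))) ⟩
  f (M + (N + m)) + g (N + (M + m))
    ≡⟨ cong₂ _+_ (f≡ (N + m)) (g≡ (M + m)) ⟩
  newton cs (N + m) + newton ds (M + m)
    ≡⟨ cong₂ _+_ (newton-iterate-advance N cs m) (newton-iterate-advance M ds m) ⟨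
  newton cs′ m + newton ds′ m
    ≡⟨ newton-⊕ cs′ ds′ m ⟨
  newton (cs′ ⊕ ds′) m ∎
  where
    open ≡-Reasoning
    cs′ = iterate advance cs N
    ds′ = iterate advance ds M
PolyOrExp-+ {f} {g} (exp M grow) _ = exp M λ m → ℕ.≤-trans (grow m) (ℕ.m≤m+n (f (M + m)) (g (M + m)))
PolyOrExp-+ {f} {g} _ (exp M grow) = exp M λ m → ℕ.≤-trans (grow m) (ℕ.m≤n+m (g (M + m)) (f (M + m)))

PolyOrExp-* : ∀ {g} a → PolyOrExp g → PolyOrExp (λ m → a * g m)
PolyOrExp-* a (poly M cs g≡) =
  poly M (map (a *_) cs) λ m → trans (cong (a *_) (g≡ m)) (sym (newton-scale a cs m))
PolyOrExp-* zero    (exp M grow) = PolyOrExp-0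
PolyOrExp-* {g} (suc a) (exp M grow) =
  exp M λ m → ℕ.≤-trans (grow m) (ℕ.m≤m+n (g (M + m)) (a * g (M + m)))

PolyOrExp-sumFin : ∀ {k} (f : Fin k → ℕ → ℕ) → (∀ i → PolyOrExp (f i)) →
                   PolyOrExp (λ m → sumFin (λ i → f i m))
PolyOrExp-sumFin {zero}  f _  = PolyOrExp-0
PolyOrExp-sumFin {suc k} f fᵢ = PolyOrExp-+ (fᵢ zero) (PolyOrExp-sumFin (f ∘ suc) (fᵢ ∘ suc))

PolyOrExp-recurrence : ∀ {g h} c → c ≤ 1 → (∀ m → g (suc m) ≡ c * g m + h m) →
                       PolyOrExp h → PolyOrExp g
PolyOrExp-recurrence 0 _ step (poly M cs h≡) = poly (suc M) cs λ m → trans (step (M + m)) (h≡ m)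
PolyOrExp-recurrence 0 _ step (exp M grow)   =
  exp (suc M) λ m → subst (2 ^ m ≤_) (sym (step (M + m))) (grow m)
PolyOrExp-recurrence {g} {h} 1 _ step (poly M cs h≡) = poly M (g M ∷ cs) sums
  where
    sums : ∀ m → g (M + m) ≡ newton (g M ∷ cs) m
    sums zero    = cong g (ℕ.+-identityʳ M)
    sums (suc m) = begin
      g (M + suc m)             ≡⟨ cong g (ℕ.+-suc M m) ⟩
      g (suc (M + m))           ≡⟨ step (M + m) ⟩
      1 * g (M + m) + h (M + m) ≡⟨ cong₂ _+_ (trans (ℕ.*-identityˡ _) (sums m)) (h≡ m) ⟩
      newton (g M ∷ cs) (suc m) ∎
      where open ≡-Reasoning
PolyOrExp-recurrence {g} {h} 1 _ step (exp M grow) =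
  exp (suc M) λ m → ℕ.≤-trans (grow m) (subst (h (M + m) ≤_) (sym (step (M + m))) (ℕ.m≤n+m _ _))
PolyOrExp-recurrence (suc (suc _)) (s≤s ())

doubling-growth : (s : ℕ → ℕ) → 1 ≤ s 1 → (∀ m → 2 * s m ≤ s (suc m)) → ∀ m → 2 ^ m ≤ s (suc m)
doubling-growth s 1≤s₁ double zero    = 1≤s₁
doubling-growth s 1≤s₁ double (suc m) =
  ℕ.≤-trans (ℕ.*-monoʳ-≤ 2 (doubling-growth s 1≤s₁ double m)) (double (suc m))

-- Columns of the powers of a matrix with transitive support

module Column {k} (B : Mat k) (transitive : TransitiveSupport B) (y : Fin k) where

  entry : Fin k → ℕ → ℕ
  entry x m = (B ^M m) x y

  entry-1 : ∀ x → entry x 1 ≡ B x y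
  entry-1 x = ⊗-identityʳ B x y

  vanishing : ∀ {x} → ¬ (0 < B x y) → ∀ m → entry x (suc m) ≡ 0
  vanishing {x} B[x,y]≯0 m = ℕ.n≤0⇒n≡0 (ℕ.≮⇒≥ (B[x,y]≯0 ∘ transitive-^M-⊑ transitive m x y))

  heavy-loop-growth : ∀ {x} → 2 ≤ B x x → 0 < B x y → ∀ m → 2 ^ m ≤ entry x (1 + m)
  heavy-loop-growth {x} 2≤Bxx 0<Bxy = doubling-growth (entry x) (subst (1 ≤_) (sym (entry-1 x)) 0<Bxy) double
    where
      double : ∀ m → 2 * entry x m ≤ entry x (suc m)
      double m = ℕ.≤-trans (ℕ.*-monoˡ-≤ (entry x m) 2≤Bxx) (≤-sumFin (λ w → B x w * entry w m) x)

  loop-and-edge-growth : ∀ a b → b ≢ a → 0 < B a a → 0 < B a b →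
                         ∀ m → entry a m + entry b m ≤ entry a (suc m)
  loop-and-edge-growth a b b≢a 0<Baa 0<Bab m = begin
    entry a m + entry b m      ≤⟨ ℕ.+-mono-≤ (ℕ.m≤n*m (entry a m) (B a a) {{>-nonZero 0<Baa}})
                                             (ℕ.m≤n*m (entry b m) (B a b) {{>-nonZero 0<Bab}}) ⟩
    F a + F b                  ≡⟨ cong (F a +_) (without-≢ F b≢a) ⟨
    F a + (F without a) b      ≤⟨ ℕ.+-monoʳ-≤ (F a) (≤-sumFin (F without a) b) ⟩
    F a + sumFin (F without a) ≡⟨ sumFin-without a F ⟨
    entry a (suc m)            ∎
    where
      open ℕ.≤-Reasoning
      F : Fin k → ℕ
      F w = B a w * entry w m

  two-cycle-growth : ∀ {x z} → z ≢ x → 0 < B x z → 0 < B z x → 0 < B x y →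
                     ∀ m → 2 ^ m ≤ entry x (2 + m)
  two-cycle-growth {x} {z} z≢x 0<Bxz 0<Bzx 0<Bxy m =
    ℕ.≤-trans (doubling-growth s 1≤s₁ double m) (loop-and-edge-growth x z z≢x 0<Bxx 0<Bxz (suc m))
    where
      0<Bxx = transitive x z x 0<Bxz 0<Bzx
      0<Bzz = transitive z x z 0<Bzx 0<Bxz
      s : ℕ → ℕ
      s m = entry x m + entry z m
      1≤s₁ : 1 ≤ s 1
      1≤s₁ = ℕ.≤-trans (subst (1 ≤_) (sym (entry-1 x)) 0<Bxy) (ℕ.m≤m+n (entry x 1) (entry z 1))
      rearrange : ∀ a b → a + b + (b + a) ≡ 2 * (a + b)
      rearrange a b = solve (a ∷ b ∷ [])
      double : ∀ m → 2 * s m ≤ s (suc m)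
      double m = subst (_≤ s (suc m)) (rearrange (entry x m) (entry z m))
        (ℕ.+-mono-≤ (loop-and-edge-growth x z z≢x 0<Bxx 0<Bxz m)
                    (loop-and-edge-growth z x (z≢x ∘ sym) 0<Bzz 0<Bzx m))

  reach : Fin k → Subset k
  reach x = ⁅ x ⁆ ∪ support (B x)

  reach-⊂ : ∀ {x w} → w ≢ x → 0 < B x w → ¬ (0 < B w x) → reach w ⊂ reach x
  reach-⊂ {x} {w} w≢x 0<Bxw B[w,x]≯0 = reach-⊆ , x , p⊆p∪q (support (B x)) (x∈⁅x⁆ x) , x∉reach-w
    where
      reach-⊆ : ∀ {v} → v ∈ reach w → v ∈ reach x
      reach-⊆ {v} v∈ with x∈p∪q⁻ ⁅ w ⁆ (support (B w)) v∈
      ... | inj₁ v∈⁅w⁆ = q⊆p∪q ⁅ x ⁆ _ (∈-support⁺ (B x) (subst (λ v → 0 < B x v) v≡w 0<Bxw))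
        where v≡w = sym (x∈⁅y⁆⇒x≡y w v∈⁅w⁆)
      ... | inj₂ v∈Bw  = q⊆p∪q ⁅ x ⁆ _ (∈-support⁺ (B x) (transitive x w v 0<Bxw (∈-support⁻ (B w) v∈Bw)))
      x∉reach-w : ¬ (x ∈ reach w)
      x∉reach-w x∈ with x∈p∪q⁻ ⁅ w ⁆ (support (B w)) x∈
      ... | inj₁ x∈⁅w⁆ = w≢x (sym (x∈⁅y⁆⇒x≡y w x∈⁅w⁆))
      ... | inj₂ x∈Bw  = B[w,x]≯0 (∈-support⁻ (B w) x∈Bw)

  PolyOrExp-from-below : ∀ x → B x x ≤ 1 → (∀ w → w ≢ x → 0 < B x w → PolyOrExp (entry w)) →
                         PolyOrExp (entry x)
  PolyOrExp-from-below x Bxx≤1 below =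
    PolyOrExp-recurrence (B x x) Bxx≤1 (λ m → sumFin-without x (F m))
      (PolyOrExp-sumFin (λ w m → (F m without x) w) term)
    where
      F : ℕ → Fin k → ℕ
      F m w = B x w * entry w m
      term : ∀ w → PolyOrExp (λ m → (F m without x) w)
      term w with w Fin.≟ x
      ... | yes _  = PolyOrExp-0
      ... | no w≢x with B x w in Bxw≡
      ...   | zero  = PolyOrExp-0
      ...   | suc c = PolyOrExp-* (suc c) (below w w≢x (subst (0 <_) (sym Bxw≡) z<s))

  entry-PolyOrExp-acc : ∀ x → Acc (_⊂_ on reach) x → PolyOrExp (entry x)
  entry-PolyOrExp-acc x (acc rec)
    with 0 <? B x y | 2 ≤? B x x | Finₚ.any? (λ z → ¬? (z Fin.≟ x) ×-dec 0 <? B x z ×-dec 0 <? B z x)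
  ... | no  B[x,y]≯0 | _         | _                              = poly 1 [] (vanishing B[x,y]≯0)
  ... | yes 0<Bxy    | yes 2≤Bxx | _                              = exp 1 (heavy-loop-growth 2≤Bxx 0<Bxy)
  ... | yes 0<Bxy    | no  _     | yes (z , z≢x , 0<Bxz , 0<Bzx) = exp 2 (two-cycle-growth z≢x 0<Bxz 0<Bzx 0<Bxy)
  ... | yes _        | no  2≰Bxx | no  no-two-cycle               =
    PolyOrExp-from-below x (ℕ.≤-pred (ℕ.≰⇒> 2≰Bxx)) λ w w≢x 0<Bxw →
      entry-PolyOrExp-acc w (rec (reach-⊂ w≢x 0<Bxw λ 0<Bwx → no-two-cycle (w , w≢x , 0<Bxw , 0<Bwx)))

  entry-PolyOrExp : ∀ x → PolyOrExp (entry x)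
  entry-PolyOrExp x = entry-PolyOrExp-acc x (On.wellFounded reach ⊂-wellFounded x)

-- Rational polynomials and binomial coefficients

mkℚ[_/1] : ℕ → ℚ
mkℚ[ n /1] = mkℚ (ℤ.+ n) 0 (Coprimality.sym (Coprimality.1-coprimeTo n))

toℚ≡mkℚ : ∀ n → toℚ n ≡ mkℚ[ n /1]
toℚ≡mkℚ n = ℚ.normalize-coprime _

toℚ-+ : ∀ m n → toℚ (m + n) ≡ toℚ m ℚ.+ toℚ n
toℚ-+ m n rewrite toℚ≡mkℚ m | toℚ≡mkℚ n =
  cong (ℚ._/ 1) (sym (cong₂ ℤ._+_ (ℤ.*-identityʳ (ℤ.+ m)) (ℤ.*-identityʳ (ℤ.+ n))))

toℚ-* : ∀ m n → toℚ (m * n) ≡ toℚ m ℚ.* toℚ n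
toℚ-* m n rewrite toℚ≡mkℚ m | toℚ≡mkℚ n = cong (ℚ._/ 1) (ℤ.pos-* m n)

toℚ-^ : ∀ m n → toℚ (m ^ n) ≡ toℚ m ^ℚ n
toℚ-^ m zero    = refl
toℚ-^ m (suc n) = trans (toℚ-* m (m ^ n)) (cong (toℚ m ℚ.*_) (toℚ-^ m n))

toℚ-mono-≤ : ∀ {m n} → m ≤ n → toℚ m ℚ.≤ toℚ n
toℚ-mono-≤ {m} {n} m≤n rewrite toℚ≡mkℚ m | toℚ≡mkℚ n =
  ℚ.*≤* (subst₂ ℤ._≤_ (sym (ℤ.*-identityʳ (ℤ.+ m))) (sym (ℤ.*-identityʳ (ℤ.+ n))) (ℤ.+≤+ m≤n))

1/[1+_] : ℕ → ℚ
1/[1+ n ] = ℚ.1/ mkℚ[ suc n /1]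

1/[1+n]*[1+n]≡1 : ∀ n → 1/[1+ n ] ℚ.* toℚ (suc n) ≡ 1ℚ
1/[1+n]*[1+n]≡1 n = trans (cong (1/[1+ n ] ℚ.*_) (toℚ≡mkℚ (suc n))) (ℚ.*-inverseˡ mkℚ[ suc n /1])

infixl 6 _+ₚ_
_+ₚ_ : List ℚ → List ℚ → List ℚ
[]       +ₚ qs       = qs
(p ∷ ps) +ₚ []       = p ∷ ps
(p ∷ ps) +ₚ (q ∷ qs) = p ℚ.+ q ∷ ps +ₚ qs

infixl 7 _·ₚ_ _*ₚ_
_·ₚ_ : ℚ → List ℚ → List ℚ
a ·ₚ ps = map (a ℚ.*_) ps

_*ₚ_ : List ℚ → List ℚ → List ℚ
[]       *ₚ qs = []
(p ∷ ps) *ₚ qs = p ·ₚ qs +ₚ (0ℚ ∷ ps *ₚ qs)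

infixr 9 _∘ₚ_
_∘ₚ_ : List ℚ → List ℚ → List ℚ
[]       ∘ₚ qs = []
(p ∷ ps) ∘ₚ qs = (p ∷ []) +ₚ qs *ₚ (ps ∘ₚ qs)

evalPoly-+ₚ : ∀ ps qs x → evalPoly (ps +ₚ qs) x ≡ evalPoly ps x ℚ.+ evalPoly qs x
evalPoly-+ₚ []       qs       x = sym (ℚ.+-identityˡ _)
evalPoly-+ₚ (p ∷ ps) []       x = sym (ℚ.+-identityʳ _)
evalPoly-+ₚ (p ∷ ps) (q ∷ qs) x rewrite evalPoly-+ₚ ps qs x =
  solveℚ 5 (λ p q x e f → p :+ q :+ x :* (e :+ f) := (p :+ x :* e) :+ (q :+ x :* f))
         refl p q x (evalPoly ps x) (evalPoly qs x)

evalPoly-·ₚ : ∀ a ps x → evalPoly (a ·ₚ ps) x ≡ a ℚ.* evalPoly ps x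
evalPoly-·ₚ a []       x = sym (ℚ.*-zeroʳ a)
evalPoly-·ₚ a (p ∷ ps) x rewrite evalPoly-·ₚ a ps x =
  solveℚ 4 (λ a p x e → a :* p :+ x :* (a :* e) := a :* (p :+ x :* e)) refl a p x (evalPoly ps x)

evalPoly-*ₚ : ∀ ps qs x → evalPoly (ps *ₚ qs) x ≡ evalPoly ps x ℚ.* evalPoly qs x
evalPoly-*ₚ []       qs x = sym (ℚ.*-zeroˡ (evalPoly qs x))
evalPoly-*ₚ (p ∷ ps) qs x
  rewrite evalPoly-+ₚ (p ·ₚ qs) (0ℚ ∷ ps *ₚ qs) x | evalPoly-·ₚ p qs x | evalPoly-*ₚ ps qs x =
  solveℚ 4 (λ p x e f → p :* f :+ (con 0ℚ :+ x :* (e :* f)) := (p :+ x :* e) :* f)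
         refl p x (evalPoly ps x) (evalPoly qs x)

evalPoly-∘ₚ : ∀ ps qs x → evalPoly (ps ∘ₚ qs) x ≡ evalPoly ps (evalPoly qs x)
evalPoly-∘ₚ []       qs x = refl
evalPoly-∘ₚ (p ∷ ps) qs x
  rewrite evalPoly-+ₚ (p ∷ []) (qs *ₚ (ps ∘ₚ qs)) x | evalPoly-*ₚ qs (ps ∘ₚ qs) x | evalPoly-∘ₚ ps qs x =
  solveℚ 3 (λ p x e → p :+ x :* con 0ℚ :+ e := p :+ e) refl p x (evalPoly qs x ℚ.* evalPoly ps (evalPoly qs x))

[X-_]/[1+_] : ℕ → ℕ → List ℚ
[X- c ]/[1+ q ] = (ℚ.- (toℚ c ℚ.* 1/[1+ q ])) ∷ 1/[1+ q ] ∷ []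

[X-c]/[1+q]-at-c+m[1+q] : ∀ c q m → evalPoly [X- c ]/[1+ q ] (toℚ (c + m * suc q)) ≡ toℚ m
[X-c]/[1+q]-at-c+m[1+q] c q m = begin
  evalPoly [X- c ]/[1+ q ] (toℚ (c + m * suc q))
    ≡⟨ cong (evalPoly [X- c ]/[1+ q ]) (trans (toℚ-+ c (m * suc q)) (cong (c′ ℚ.+_) (toℚ-* m (suc q)))) ⟩
  evalPoly [X- c ]/[1+ q ] (c′ ℚ.+ m′ ℚ.* p)
    ≡⟨ solveℚ 4 (λ c′ a m′ p → (:- (c′ :* a)) :+ (c′ :+ m′ :* p) :* (a :+ (c′ :+ m′ :* p) :* con 0ℚ)
                               := m′ :* (a :* p)) refl c′ a m′ p ⟩
  m′ ℚ.* (a ℚ.* p)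
    ≡⟨ cong (m′ ℚ.*_) (1/[1+n]*[1+n]≡1 q) ⟩
  m′ ℚ.* 1ℚ
    ≡⟨ ℚ.*-identityʳ m′ ⟩
  m′ ∎
  where
    open ≡-Reasoning
    c′ = toℚ c
    m′ = toℚ m
    p  = toℚ (suc q)
    a  = 1/[1+ q ]

absorption : ∀ m j → suc j * (m C suc j) + j * (m C j) ≡ m * (m C j)
absorption m       zero    = trans (cong (λ b → 1 * b + 0) (nC1≡n m)) (solve (m ∷ []))
absorption zero    (suc j) = solve (j ∷ [])
absorption (suc m) (suc j) = begin
  suc (suc j) * (suc m C suc (suc j)) + suc j * (suc m C suc j)
    ≡⟨ cong₂ (λ x y → suc (suc j) * x + suc j * y) (pascal m (suc j)) (pascal m j) ⟨
  suc (suc j) * (b + c) + suc j * (a + b)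
    ≡⟨ regroup j a b c ⟩
  (suc (suc j) * c + suc j * b) + (suc j * b + j * a) + (a + b)
    ≡⟨ cong₂ (λ x y → x + y + (a + b)) (absorption m (suc j)) (absorption m j) ⟩
  m * b + m * a + (a + b)
    ≡⟨ collect m a b ⟩
  suc m * (a + b)
    ≡⟨ cong (suc m *_) (pascal m j) ⟩
  suc m * (suc m C suc j) ∎
  where
    open ≡-Reasoning
    a = m C j
    b = m C suc j
    c = m C suc (suc j)
    regroup : ∀ j a b c → suc (suc j) * (b + c) + suc j * (a + b) ≡
                          (suc (suc j) * c + suc j * b) + (suc j * b + j * a) + (a + b)
    regroup j a b c = solve (j ∷ a ∷ b ∷ c ∷ [])
    collect : ∀ m a b → m * b + m * a + (a + b) ≡ suc m * (a + b)
    collect m a b = solve (m ∷ a ∷ b ∷ [])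

binomialPoly : ℕ → List ℚ
binomialPoly zero    = 1ℚ ∷ []
binomialPoly (suc j) = [X- j ]/[1+ j ] *ₚ binomialPoly j

binomialPoly-eval : ∀ j m → evalPoly (binomialPoly j) (toℚ m) ≡ toℚ (m C j)
binomialPoly-eval zero    m = solveℚ 1 (λ x → con 1ℚ :+ x :* con 0ℚ := con 1ℚ) refl (toℚ m)
binomialPoly-eval (suc j) m = begin
  evalPoly ([X- j ]/[1+ j ] *ₚ binomialPoly j) m′
    ≡⟨ evalPoly-*ₚ [X- j ]/[1+ j ] (binomialPoly j) m′ ⟩
  evalPoly [X- j ]/[1+ j ] m′ ℚ.* evalPoly (binomialPoly j) m′
    ≡⟨ cong (evalPoly [X- j ]/[1+ j ] m′ ℚ.*_) (binomialPoly-eval j m) ⟩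
  evalPoly [X- j ]/[1+ j ] m′ ℚ.* Y
    ≡⟨ solveℚ 4 (λ j′ a m′ Y → ((:- (j′ :* a)) :+ m′ :* (a :+ m′ :* con 0ℚ)) :* Y
                               := a :* (m′ :* Y :+ (:- (j′ :* Y)))) refl j′ a m′ Y ⟩
  a ℚ.* (m′ ℚ.* Y ℚ.- j′ ℚ.* Y)
    ≡⟨ cong (λ z → a ℚ.* (z ℚ.- j′ ℚ.* Y)) absorptionℚ ⟨
  a ℚ.* (j₁ ℚ.* X ℚ.+ j′ ℚ.* Y ℚ.- j′ ℚ.* Y)
    ≡⟨ solveℚ 5 (λ j′ j₁ a X Y → a :* (j₁ :* X :+ j′ :* Y :+ (:- (j′ :* Y))) := (a :* j₁) :* X)
              refl j′ j₁ a X Y ⟩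
  (a ℚ.* j₁) ℚ.* X
    ≡⟨ cong (ℚ._* X) (1/[1+n]*[1+n]≡1 j) ⟩
  1ℚ ℚ.* X
    ≡⟨ ℚ.*-identityˡ X ⟩
  X ∎
  where
    open ≡-Reasoning
    m′ = toℚ m
    j′ = toℚ j
    j₁ = toℚ (suc j)
    a  = 1/[1+ j ]
    X  = toℚ (m C suc j)
    Y  = toℚ (m C j)
    absorptionℚ : j₁ ℚ.* X ℚ.+ j′ ℚ.* Y ≡ m′ ℚ.* Y
    absorptionℚ = begin
      j₁ ℚ.* X ℚ.+ j′ ℚ.* Y
        ≡⟨ cong₂ ℚ._+_ (toℚ-* (suc j) (m C suc j)) (toℚ-* j (m C j)) ⟨
      toℚ (suc j * (m C suc j)) ℚ.+ toℚ (j * (m C j))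
        ≡⟨ toℚ-+ (suc j * (m C suc j)) (j * (m C j)) ⟨
      toℚ (suc j * (m C suc j) + j * (m C j))
        ≡⟨ cong toℚ (absorption m j) ⟩
      toℚ (m * (m C j))
        ≡⟨ toℚ-* m (m C j) ⟩
      m′ ℚ.* Y ∎

binomialSum : ℕ → List ℕ → ℕ → ℕ
binomialSum j []       m = 0
binomialSum j (c ∷ cs) m = c * (m C j) + binomialSum (suc j) cs m

binomialSum-at-0 : ∀ j cs → binomialSum (suc j) cs 0 ≡ 0
binomialSum-at-0 j []       = refl
binomialSum-at-0 j (c ∷ cs) =
  trans (cong (c * 0 +_) (binomialSum-at-0 (suc j) cs)) (trans (ℕ.+-identityʳ (c * 0)) (ℕ.*-zeroʳ c))

binomialSum-pascal : ∀ j cs m →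
                     binomialSum (suc j) cs (suc m) ≡ binomialSum (suc j) cs m + binomialSum j cs m
binomialSum-pascal j []       m = refl
binomialSum-pascal j (c ∷ cs) m = begin
  c * (suc m C suc j) + binomialSum (suc (suc j)) cs (suc m)
    ≡⟨ cong₂ (λ x y → c * x + y) (pascal m j) (sym (binomialSum-pascal (suc j) cs m)) ⟨
  c * (m C j + m C suc j) + (binomialSum (suc (suc j)) cs m + binomialSum (suc j) cs m)
    ≡⟨ regroup c (m C j) (m C suc j) _ _ ⟩
  (c * (m C suc j) + binomialSum (suc (suc j)) cs m) + (c * (m C j) + binomialSum (suc j) cs m) ∎
  where
    open ≡-Reasoning
    regroup : ∀ c a b x y → c * (a + b) + (x + y) ≡ (c * b + x) + (c * a + y)
    regroup c a b x y = solve (c ∷ a ∷ b ∷ x ∷ y ∷ [])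

newton≡binomialSum : ∀ cs m → newton cs m ≡ binomialSum 0 cs m
newton≡binomialSum []       m       = refl
newton≡binomialSum (c ∷ cs) zero    =
  sym (trans (cong (c * 1 +_) (binomialSum-at-0 0 cs)) (trans (ℕ.+-identityʳ (c * 1)) (ℕ.*-identityʳ c)))
newton≡binomialSum (c ∷ cs) (suc m) = begin
  newton (c ∷ cs) m + newton cs m
    ≡⟨ cong₂ _+_ (newton≡binomialSum (c ∷ cs) m) (newton≡binomialSum cs m) ⟩
  c * 1 + binomialSum 1 cs m + binomialSum 0 cs m
    ≡⟨ ℕ.+-assoc (c * 1) _ _ ⟩
  c * 1 + (binomialSum 1 cs m + binomialSum 0 cs m)
    ≡⟨ cong (c * 1 +_) (binomialSum-pascal 0 cs m) ⟨
  c * 1 + binomialSum 1 cs (suc m) ∎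
  where open ≡-Reasoning

binomialSumPoly : ℕ → List ℕ → List ℚ
binomialSumPoly j []       = []
binomialSumPoly j (c ∷ cs) = toℚ c ·ₚ binomialPoly j +ₚ binomialSumPoly (suc j) cs

binomialSumPoly-eval : ∀ j cs m → evalPoly (binomialSumPoly j cs) (toℚ m) ≡ toℚ (binomialSum j cs m)
binomialSumPoly-eval j []       m = refl
binomialSumPoly-eval j (c ∷ cs) m = begin
  evalPoly (toℚ c ·ₚ binomialPoly j +ₚ binomialSumPoly (suc j) cs) m′
    ≡⟨ evalPoly-+ₚ (toℚ c ·ₚ binomialPoly j) (binomialSumPoly (suc j) cs) m′ ⟩
  evalPoly (toℚ c ·ₚ binomialPoly j) m′ ℚ.+ evalPoly (binomialSumPoly (suc j) cs) m′
    ≡⟨ cong₂ ℚ._+_ (trans (evalPoly-·ₚ (toℚ c) (binomialPoly j) m′)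
                          (cong (toℚ c ℚ.*_) (binomialPoly-eval j m)))
                   (binomialSumPoly-eval (suc j) cs m) ⟩
  toℚ c ℚ.* toℚ (m C j) ℚ.+ toℚ (binomialSum (suc j) cs m)
    ≡⟨ cong (ℚ._+ toℚ (binomialSum (suc j) cs m)) (toℚ-* c (m C j)) ⟨
  toℚ (c * (m C j)) ℚ.+ toℚ (binomialSum (suc j) cs m)
    ≡⟨ toℚ-+ (c * (m C j)) (binomialSum (suc j) cs m) ⟨
  toℚ (binomialSum j (c ∷ cs) m) ∎
  where
    open ≡-Reasoning
    m′ = toℚ m

newtonPoly : List ℕ → List ℚ
newtonPoly = binomialSumPoly 0

newtonPoly-eval : ∀ cs m → evalPoly (newtonPoly cs) (toℚ m) ≡ toℚ (newton cs m)
newtonPoly-eval cs m = trans (binomialSumPoly-eval 0 cs m) (cong toℚ (sym (newton≡binomialSum cs m)))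

-- Residue classes

n≤2^n : ∀ n → n ≤ 2 ^ n
n≤2^n zero    = z≤n
n≤2^n (suc n) = ℕ.+-mono-≤ (ℕ.m^n>0 2 n) (ℕ.≤-trans (n≤2^n n) (ℕ.m≤m+n (2 ^ n) 0))

^M-≤-2^ : ∀ {k} (A : Mat k) u v n → (A ^M n) u v ≤ 2 ^ (suc (mass A) * n)
^M-≤-2^ A u v n = begin
  (A ^M n) u v           ≤⟨ ^M-≤-mass^ A n u v ⟩
  mass A ^ n             ≤⟨ ℕ.^-monoˡ-≤ n (n≤2^n (mass A)) ⟩
  (2 ^ mass A) ^ n       ≡⟨ ℕ.^-*-assoc 2 (mass A) n ⟩
  2 ^ (mass A * n)       ≤⟨ ℕ.^-monoʳ-≤ 2 (ℕ.m≤n+m (mass A * n) n) ⟩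
  2 ^ (suc (mass A) * n) ∎
  where open ℕ.≤-Reasoning

IsExpTheta-toℚ : ∀ (g : ℕ → ℕ) b c N →
                 (∀ n → N ≤ n → 2 ^ n ≤ g n ^ suc b × g n ≤ 2 ^ (suc c * n)) →
                 IsExpTheta (λ n → toℚ (g n))
IsExpTheta-toℚ g b c N bounds = 0 , b , suc c , 0 , s≤s z≤n , N , λ n N≤n →
    toℚ-mono-≤ {0} {g n} z≤n
  , subst₂ ℚ._≤_ (cong (toℚ ∘ (2 ^_)) (sym (ℕ.*-identityˡ n))) (toℚ-^ (g n) (suc b))
                 (toℚ-mono-≤ (proj₁ (bounds n N≤n)))
  , subst (ℚ._≤ toℚ (2 ^ (suc c * n))) (toℚ-^ (g n) 1)
          (toℚ-mono-≤ (subst (_≤ 2 ^ (suc c * n)) (sym (ℕ.*-identityʳ (g n))) (proj₂ (bounds n N≤n))))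

record Constituent (f : ℕ → ℕ) (q r : ℕ) : Set where
  field
    φ      : ℕ → ℚ
    shape  : IsPolynomial φ ⊎ IsExpTheta φ
    start  : ℕ
    agrees : ∀ n → start ≤ n → n % suc q ≡ r → toℚ (f n) ≡ φ n

constituents⇒UltimatelyAlmostPORC : ∀ {f} q → (∀ (i : Fin (suc q)) → Constituent f q (toℕ i)) →
                                    UltimatelyAlmostPORC f
constituents⇒UltimatelyAlmostPORC q κ = q , sumFin (start ∘ κ) , φ ∘ κ , shape ∘ κ , λ n N≤n →
  agrees (κ (n mod suc q)) n (ℕ.≤-trans (≤-sumFin (start ∘ κ) (n mod suc q)) N≤n)
         (sym (Finₚ.toℕ-fromℕ< _))
  where open Constituent

residue-class-beyond : ∀ {q r M n} → n % suc q ≡ r → r + M * suc q ≤ n →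
                       ∃ λ m → n ≡ r + (M + m) * suc q
residue-class-beyond {q} {r} {M} {n} n%p≡r r+Mp≤n = t ∸ M , (begin
  n                         ≡⟨ n≡r+tp ⟩
  r + t * suc q             ≡⟨ cong (λ x → r + x * suc q) (ℕ.m+[n∸m]≡n M≤t) ⟨
  r + (M + (t ∸ M)) * suc q ∎)
  where
    open ≡-Reasoning
    t = n / suc q
    n≡r+tp : n ≡ r + t * suc q
    n≡r+tp = trans (m≡m%n+[m/n]*n n (suc q)) (cong (_+ t * suc q) n%p≡r)
    M≤t : M ≤ t
    M≤t = ℕ.*-cancelʳ-≤ M t (suc q) (ℕ.+-cancelˡ-≤ r _ _ (subst (r + M * suc q ≤_) n≡r+tp r+Mp≤n))

poly-constituent : ∀ {f q r} M cs → (∀ m → f (r + (M + m) * suc q) ≡ newton cs m) → Constituent f q r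
poly-constituent {f} {q} {r} M cs f≡ = record
  { φ      = λ n → evalPoly P (toℚ n)
  ; shape  = inj₁ (P , λ _ → refl)
  ; start  = o
  ; agrees = agrees
  }
  where
    o = r + M * suc q
    P = newtonPoly cs ∘ₚ [X- o ]/[1+ q ]
    agrees : ∀ n → o ≤ n → n % suc q ≡ r → toℚ (f n) ≡ evalPoly P (toℚ n)
    agrees n o≤n n%p≡r with residue-class-beyond {M = M} n%p≡r o≤n
    ... | m , refl = begin
      toℚ (f n)                                                   ≡⟨ cong toℚ (f≡ m) ⟩
      toℚ (newton cs m)                                           ≡⟨ newtonPoly-eval cs m ⟨
      evalPoly (newtonPoly cs) (toℚ m)                            ≡⟨ cong (evalPoly (newtonPoly cs)) X-o/[1+q]≡m ⟨
      evalPoly (newtonPoly cs) (evalPoly [X- o ]/[1+ q ] (toℚ n)) ≡⟨ evalPoly-∘ₚ (newtonPoly cs) _ (toℚ n) ⟨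
      evalPoly P (toℚ n)                                          ∎
      where
        open ≡-Reasoning
        n≡o+mp : r + (M + m) * suc q ≡ r + M * suc q + m * suc q
        n≡o+mp = solve (r ∷ M ∷ m ∷ q ∷ [])
        X-o/[1+q]≡m : evalPoly [X- o ]/[1+ q ] (toℚ n) ≡ toℚ m
        X-o/[1+q]≡m = trans (cong (evalPoly [X- o ]/[1+ q ] ∘ toℚ) n≡o+mp) ([X-c]/[1+q]-at-c+m[1+q] o q m)

-- Off its residue class the constituent is 2ⁿ, which keeps it in 2^Θ(n) everywhere.
exp-constituent : ∀ {f q r} c M → (∀ n → f n ≤ 2 ^ (suc c * n)) →
                  (∀ m → 2 ^ m ≤ f (r + (M + m) * suc q)) → Constituent f q r
exp-constituent {f} {q} {r} c M f≤2^ grow = record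
  { φ      = λ n → toℚ (g n)
  ; shape  = inj₂ (IsExpTheta-toℚ g (suc q) c (r + (M + o) * suc q) bounds)
  ; start  = 0
  ; agrees = λ n _ n%p≡r → cong toℚ (sym (g-on-class n n%p≡r))
  }
  where
    o = r + M * suc q
    g : ℕ → ℕ
    g n with n % suc q ℕ.≟ r
    ... | yes _ = f n
    ... | no  _ = 2 ^ n
    g-on-class : ∀ n → n % suc q ≡ r → g n ≡ f n
    g-on-class n n%p≡r with n % suc q ℕ.≟ r
    ... | yes _    = refl
    ... | no n%p≢r = contradiction n%p≡r n%p≢r
    bounds : ∀ n → r + (M + o) * suc q ≤ n → 2 ^ n ≤ g n ^ suc (suc q) × g n ≤ 2 ^ (suc c * n)
    bounds n start≤n with n % suc q ℕ.≟ r
    ... | no _ = ℕ.m≤m*n (2 ^ n) ((2 ^ n) ^ suc q) {{ℕ.m^n≢0 (2 ^ n) (suc q) {{ℕ.m^n≢0 2 n}}}}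
               , ℕ.^-monoʳ-≤ 2 (ℕ.m≤m+n n (c * n))
    ... | yes n%p≡r with residue-class-beyond {M = M + o} n%p≡r start≤n
    ...   | m′ , refl = lower , f≤2^ _
      where
        open ℕ.≤-Reasoning
        m = o + m′
        regroup : r + (M + (r + M * suc q) + m′) * suc q ≡ r + M * suc q + (r + M * suc q + m′) * suc q
        regroup = solve (r ∷ M ∷ m′ ∷ q ∷ [])
        n≤m[1+p] : r + (M + o + m′) * suc q ≤ m * suc (suc q)
        n≤m[1+p] = begin
          r + (M + o + m′) * suc q ≡⟨ regroup ⟩
          o + m * suc q            ≤⟨ ℕ.+-monoˡ-≤ (m * suc q) (ℕ.m≤m+n o m′) ⟩
          m + m * suc q            ≡⟨ ℕ.*-suc m (suc q) ⟨
          m * suc (suc q)          ∎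
        lower : 2 ^ (r + (M + o + m′) * suc q) ≤ f (r + (M + o + m′) * suc q) ^ suc (suc q)
        lower = begin
          2 ^ (r + (M + o + m′) * suc q)
            ≤⟨ ℕ.^-monoʳ-≤ 2 n≤m[1+p] ⟩
          2 ^ (m * suc (suc q))
            ≡⟨ ℕ.^-*-assoc 2 m (suc (suc q)) ⟨
          (2 ^ m) ^ suc (suc q)
            ≤⟨ ℕ.^-monoˡ-≤ (suc (suc q)) (grow m) ⟩
          f (r + (M + m) * suc q) ^ suc (suc q)
            ≡⟨ cong (λ x → f (r + x * suc q) ^ suc (suc q)) (ℕ.+-assoc M o m′) ⟨
          f (r + (M + o + m′) * suc q) ^ suc (suc q) ∎

PolyOrExp⇒Constituent : ∀ {f q r} c → (∀ n → f n ≤ 2 ^ (suc c * n)) →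
                        PolyOrExp (λ m → f (r + m * suc q)) → Constituent f q r
PolyOrExp⇒Constituent c f≤2^ (poly M cs f≡) = poly-constituent M cs f≡
PolyOrExp⇒Constituent c f≤2^ (exp M grow)   = exp-constituent c M f≤2^ grow

residue-PolyOrExp : ∀ {k} (A : Mat k) u v {q} → TransitiveSupport (A ^M suc q) →
                    ∀ r → PolyOrExp (λ m → (A ^M (r + m * suc q)) u v)
residue-PolyOrExp A u v {q} transitive r =
  PolyOrExp-cong split (PolyOrExp-sumFin _ λ y → PolyOrExp-* ((A ^M r) u y) (entry-PolyOrExp y))
  where
    open Column (A ^M suc q) transitive v
    split : ∀ m → sumFin (λ y → (A ^M r) u y * entry y m) ≡ (A ^M (r + m * suc q)) u v
    split m = sym (trans (^M-+ A r (m * suc q) u v) (⊗-cong (≋-refl {A = A ^M r}) (^M-* A m (suc q)) u v))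

lemma24 : (k : ℕ) (A : Mat k) (u v : Fin k) →
    UltimatelyAlmostPORC (λ n → (A ^M n) u v)
lemma24 k A u v =
  let q , transitive = transitive-power A in
  constituents⇒UltimatelyAlmostPORC q λ i →
    PolyOrExp⇒Constituent (mass A) (^M-≤-2^ A u v) (residue-PolyOrExp A u v transitive (toℕ i))
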